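{- Every elementary lattice-regular $n$-dimensional lattice cube in $\mathbb R^n$ contains at most one lattice point in its interior. If it contains an interior lattice point, this point is the common intersection point of the diagonals of the cube.
   Context: The lattice is $\mathbb Z^n\subset\mathbb R^n$ with origin $O$. A lattice cube is a set $\{A+\sum_{i=1}^n\alpha_i\bar v_i:0\le\alpha_i\le1\}$ with $A\in\mathbb Z^n$ and $\bar v_1,\dots,\bar v_n$ linearly independent lattice vectors. A lattice-affine transformation is an affine bijection of $\mathbb R^n$ mapping $\mathbb Z^n$ onto itself; lattice polytopes are lattice-congruent if one is mapped onto the other by such a map. A face-flag of an $n$-dimensional polytope $P$ is a chain $P=F_n\supset\dots\supset F_0$ of faces with $\dim F_i=i$; $P$ is lattice-regular if for any two face-flags some lattice-affine transformation maps $P$ onto itself and one flag onto the other. If $Q$ has vertices $O+\bar w_i$, its $t$-multiple has vertices $O+t\bar w_i$; a lattice polytope $P$ is elementary if for no integer $t>1$ and no lattice polytope $Q$ is $P$ lattice-congruent to the $t$-multiple of $Q$. -}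

module Defs where

open import Data.Nat as ℕ using (ℕ; zero; suc)
open import Data.Integer as ℤ using (ℤ; +_)
open import Data.Rational as ℚ using (ℚ; 0ℚ; 1ℚ; ½)
open import Data.Fin using (Fin; zero; suc; toℕ; inject₁; _≟_)
open import Data.Bool using (Bool; true; false; if_then_else_)
open import Data.List using (List; []; _∷_; _++_; length; map; lookup; concatMap)
open import Data.Product using (Σ; ∃; _×_; _,_)
open import Data.Sum using (_⊎_)
open import Relation.Binary.PropositionalEquality using (_≡_)
open import Relation.Nullary using (¬_; does)

Pt : ℕ → Set
Pt n = Fin n → ℤ

QPt : ℕ → Set
QPt n = Fin n → ℚ

toQ : ∀ {n} → Pt n → QPt n
toQ p j = p j ℚ./ 1

sumℤ : ∀ {n} → (Fin n → ℤ) → ℤ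
sumℤ {zero} f = ℤ.0ℤ
sumℤ {suc n} f = f zero ℤ.+ sumℤ (λ i → f (suc i))

sumℚ : ∀ {n} → (Fin n → ℚ) → ℚ
sumℚ {zero} f = 0ℚ
sumℚ {suc n} f = f zero ℚ.+ sumℚ (λ i → f (suc i))

-- Convex hulls of finite lists of points (rational convex combinations
-- suffice since all generators are lattice points).

InHull : ∀ {n} → List (QPt n) → QPt n → Set
InHull {n} ys x =
  Σ (Fin (length ys) → ℚ) λ c →
    (∀ k → 0ℚ ℚ.≤ c k) × (sumℚ c ≡ 1ℚ) ×
    (∀ j → sumℚ (λ k → c k ℚ.* lookup ys k j) ≡ x j)

-- conv xs = conv ys as subsets of ℝⁿ
SameHull : ∀ {n} → List (QPt n) → List (QPt n) → Set
SameHull xs ys =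
  (∀ k → InHull ys (lookup xs k)) × (∀ k → InHull xs (lookup ys k))

Mat : ℕ → Set
Mat n = Fin n → Fin n → ℤ

idMat : ∀ {n} → Mat n
idMat i j = if does (i ≟ j) then ℤ.1ℤ else ℤ.0ℤ

_⊗_ : ∀ {n} → Mat n → Mat n → Mat n
(M ⊗ N) i j = sumℤ (λ k → M i k ℤ.* N k j)

record LatAff (n : ℕ) : Set where
  field
    M    : Mat n
    Minv : Mat n
    b    : Pt n
    invˡ : ∀ i j → (Minv ⊗ M) i j ≡ idMat i j
    invʳ : ∀ i j → (M ⊗ Minv) i j ≡ idMat i j

apply : ∀ {n} → LatAff n → Pt n → Pt n
apply T p j = sumℤ (λ k → LatAff.M T j k ℤ.* p k) ℤ.+ LatAff.b T j

-- Lattice cube {A + Σ αᵢ vᵢ : 0 ≤ αᵢ ≤ 1}, given by A and v : Fin n → Pt n.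

LinIndep : ∀ {n} → (Fin n → Pt n) → Set
LinIndep {n} v = (c : Fin n → ℚ) →
  (∀ j → sumℚ (λ i → c i ℚ.* toQ (v i) j) ≡ 0ℚ) → ∀ i → c i ≡ 0ℚ

consB : ∀ {n} → Bool → (Fin n → Bool) → (Fin (suc n) → Bool)
consB x f zero = x
consB x f (suc i) = f i

vertex : ∀ {n} → Pt n → (Fin n → Pt n) → (Fin n → Bool) → Pt n
vertex A v β j = A j ℤ.+ sumℤ (λ i → if β i then v i j else ℤ.0ℤ)

-- Faces of the cube: each coordinate αᵢ is fixed to 0, fixed to 1, or free.
data Pat : Set where
  fix0 fix1 free : Pat

Face : ℕ → Set
Face n = Fin n → Pat

dimF : ∀ {n} → Face n → ℕ
dimF {zero} f = 0
dimF {suc n} f with f zero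
... | free = suc (dimF (λ i → f (suc i)))
... | fix0 = dimF (λ i → f (suc i))
... | fix1 = dimF (λ i → f (suc i))

faceBools : ∀ {n} → Face n → List (Fin n → Bool)
faceBools {zero} f = (λ ()) ∷ []
faceBools {suc n} f with f zero
... | fix0 = map (consB false) (faceBools (λ i → f (suc i)))
... | fix1 = map (consB true) (faceBools (λ i → f (suc i)))
... | free = map (consB false) (faceBools (λ i → f (suc i)))
             ++ map (consB true) (faceBools (λ i → f (suc i)))

fullFace : ∀ {n} → Face n
fullFace i = free

_⊆F_ : ∀ {n} → Face n → Face n → Set
f ⊆F g = ∀ i → (g i ≡ free) ⊎ (g i ≡ f i)

record Flag (n : ℕ) : Set where
  field
    F     : Fin (suc n) → Face n
    dimOK : ∀ k → dimF (F k) ≡ toℕ k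
    chain : ∀ (k : Fin n) → F (inject₁ k) ⊆F F (suc k)

faceVerts : ∀ {n} → Pt n → (Fin n → Pt n) → Face n → List (QPt n)
faceVerts A v f = map (λ β → toQ (vertex A v β)) (faceBools f)

imgFaceVerts : ∀ {n} → LatAff n → Pt n → (Fin n → Pt n) → Face n → List (QPt n)
imgFaceVerts T A v f = map (λ β → toQ (apply T (vertex A v β))) (faceBools f)

LatticeRegular : ∀ {n} → Pt n → (Fin n → Pt n) → Set
LatticeRegular {n} A v = (Φ Ψ : Flag n) → Σ (LatAff n) λ T →
  SameHull (imgFaceVerts T A v fullFace) (faceVerts A v fullFace) ×
  (∀ k → SameHull (imgFaceVerts T A v (Flag.F Φ k)) (faceVerts A v (Flag.F Ψ k)))

-- t-multiple of a lattice polytope Q = conv(ws): conv(t·ws)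
scale : ∀ {n} → ℕ → Pt n → Pt n
scale t w j = + t ℤ.* w j

Elementary : ∀ {n} → Pt n → (Fin n → Pt n) → Set
Elementary {n} A v = ¬ (Σ ℕ λ t → (2 ℕ.≤ t) × Σ (List (Pt n)) λ ws →
  Σ (LatAff n) λ T →
    SameHull (imgFaceVerts T A v fullFace) (map (λ w → toQ (scale t w)) ws))

InteriorPt : ∀ {n} → Pt n → (Fin n → Pt n) → Pt n → Set
InteriorPt A v p = Σ (_ → ℚ) λ α →
  (∀ i → (0ℚ ℚ.< α i) × (α i ℚ.< 1ℚ)) ×
  (∀ j → toQ p j ≡ toQ A j ℚ.+ sumℚ (λ i → α i ℚ.* toQ (v i) j))

center : ∀ {n} → Pt n → (Fin n → Pt n) → QPt n
center A v j = toQ A j ℚ.+ ½ ℚ.* sumℚ (λ i → toQ (v i) j)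

{-# OPTIONS --safe #-}
module Submission where

-- Write an interior lattice point as p = A + Σ αᵢ vᵢ with 0 < αᵢ < 1. Lattice-regularity yields a
-- lattice-affine map T of the cube sending the flag of coordinate faces at the corner A to the
-- same flag at the corner A + vᵢ; following the two flags face by face shows that T acts on cube
-- coordinates by αᵢ ↦ 1 − αᵢ and fixes the others, so T p − p = r vᵢ with r = 1 − 2αᵢ is a
-- lattice vector. A second such map, sending the edge along vᵢ at A to the edge along vₜ, moves
-- the lattice point A + r vᵢ to A + r vₜ, so every r vₜ is a lattice vector. If r ≠ 0, its
-- reduced denominator d ≥ 2 divides every edge vector, and the cube translated by −A is the
-- d-multiple of a lattice cube, contradicting elementarity. Hence every αᵢ = ½.

open import Defs
open import Level using (0ℓ)
open import Algebra.Bundles using (CommutativeRing)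
import Algebra.Properties.CommutativeMonoid.Sum as CommutativeMonoidSum
import Algebra.Properties.Group as GroupProperties
import Algebra.Properties.Ring as RingProperties
open import Data.Bool using (Bool; true; false; not; _∨_; _xor_; if_then_else_)
open import Data.Empty using (⊥-elim)
open import Data.Fin as Fin using (Fin; zero; suc; toℕ; inject₁; _≟_)
open import Data.Fin.Permutation as Perm using (Permutation′; _⟨$⟩ʳ_)
open import Data.Fin.Properties using (toℕ-inject₁; toℕ-injective; toℕ≤pred[n]; punchInᵢ≢i)
open import Data.Integer as ℤ using (ℤ)
import Data.Integer.Coprimality as ℤC
open import Data.Integer.Divisibility.Signed using (_∣_; divides; ∣ᵤ⇒∣; ∣⇒∣ᵤ)
import Data.Integer.Properties as ℤP
open import Data.Integer.Solver renaming (module +-*-Solver to ℤ-Solver)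
open import Data.List using (List; _∷_; map; lookup; length)
open import Data.List.Membership.Propositional.Properties using (∈-lookup)
open import Data.List.Properties using (map-∘)
open import Data.List.Relation.Unary.All as All using (All)
import Data.List.Relation.Unary.All.Properties as All
open import Data.List.Relation.Unary.Any as Any using (Any; here; there)
import Data.List.Relation.Unary.Any.Properties as Any
open import Data.Nat as ℕ using (ℕ; zero; suc; _⊓_)
import Data.Nat.Coprimality as ℕC
import Data.Nat.Properties as ℕP
open import Data.Product using (∃; _×_; _,_; proj₁; proj₂)
import Data.Rational as ℚ
import Data.Rational.Properties as ℚP
open import Data.Rational.Solver renaming (module +-*-Solver to ℚ-Solver)
open import Data.Rational.Unnormalised as ℚᵘ using (mkℚᵘ; *≡*)
import Data.Rational.Unnormalised.Properties as ℚᵘP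
open import Data.Sum using (_⊎_; inj₁; inj₂)
open import Data.Unit using (⊤; tt)
open import Function using (_∘_)
open import Function.Bundles using (Injection)
open import Function.Properties.Inverse using (↔⇒↣)
open import Relation.Binary.Definitions using (tri<; tri≈; tri>)
import Relation.Binary.PropositionalEquality as ≡
open import Relation.Nullary using (¬_; Dec; does; yes; no)
open import Relation.Nullary.Decidable using (dec-true; dec-false)

open ≡ using (_≢_)

module FinSum (R : CommutativeRing 0ℓ 0ℓ) where

  open CommutativeRing R hiding (zero)
  open import Algebra.Properties.Semiring.Sum semiring
  open import Algebra.Properties.Ring ring using (-1*x≈-x)
  open import Relation.Binary.Reasoning.Setoid setoid

  module Properties (Σ : ∀ {n} → (Fin n → Carrier) → Carrier)
                    (Σ-zero : (f : Fin 0 → Carrier) → Σ f ≈ 0#)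
                    (Σ-suc : ∀ {n} (f : Fin (suc n) → Carrier) → Σ f ≈ f zero + Σ (f ∘ suc)) where

    Σ≈sum : ∀ {n} (f : Fin n → Carrier) → Σ f ≈ sum f
    Σ≈sum {zero} f = Σ-zero f
    Σ≈sum {suc n} f = trans (Σ-suc f) (+-congˡ (Σ≈sum (f ∘ suc)))

    Σ-cong : ∀ {n} {f g : Fin n → Carrier} → (∀ i → f i ≈ g i) → Σ f ≈ Σ g
    Σ-cong {f = f} {g} f≈g = begin
      Σ f   ≈⟨ Σ≈sum f ⟩
      sum f ≈⟨ sum-cong-≋ f≈g ⟩
      sum g ≈⟨ Σ≈sum g ⟨
      Σ g   ∎

    Σ-zeros : ∀ {n} {f : Fin n → Carrier} → (∀ i → f i ≈ 0#) → Σ f ≈ 0#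
    Σ-zeros {n} {f} f≈0 = begin
      Σ f                ≈⟨ Σ≈sum f ⟩
      sum f              ≈⟨ sum-cong-≋ f≈0 ⟩
      sum {n} (λ _ → 0#) ≈⟨ sum-replicate-zero n ⟩
      0#                 ∎

    Σ-single : ∀ {n} {f : Fin n → Carrier} k → (∀ i → i ≢ k → f i ≈ 0#) → Σ f ≈ f k
    Σ-single {suc n} {f} k others≈0 = begin
      Σ f                            ≈⟨ Σ≈sum f ⟩
      sum f                          ≈⟨ sum-remove f ⟩
      f k + sum (f ∘ Fin.punchIn k)  ≈⟨ +-congˡ (trans (sym (Σ≈sum _)) (Σ-zeros others≈0′)) ⟩
      f k + 0#                       ≈⟨ +-identityʳ (f k) ⟩
      f k                            ∎
      where
      others≈0′ : ∀ i → f (Fin.punchIn k i) ≈ 0#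
      others≈0′ i = others≈0 (Fin.punchIn k i) (punchInᵢ≢i k i)

    Σ-distrib-+ : ∀ {n} (f g : Fin n → Carrier) → Σ (λ i → f i + g i) ≈ Σ f + Σ g
    Σ-distrib-+ f g = begin
      Σ (λ i → f i + g i)   ≈⟨ Σ≈sum _ ⟩
      sum (λ i → f i + g i) ≈⟨ ∑-distrib-+ f g ⟩
      sum f + sum g         ≈⟨ +-cong (Σ≈sum f) (Σ≈sum g) ⟨
      Σ f + Σ g             ∎

    *-distribˡ-Σ : ∀ {n} c (f : Fin n → Carrier) → c * Σ f ≈ Σ (λ i → c * f i)
    *-distribˡ-Σ c f = begin
      c * Σ f             ≈⟨ *-congˡ (Σ≈sum f) ⟩
      c * sum f           ≈⟨ *-distribˡ-sum c f ⟩
      sum (λ i → c * f i) ≈⟨ Σ≈sum _ ⟨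
      Σ (λ i → c * f i)   ∎

    *-distribʳ-Σ : ∀ {n} c (f : Fin n → Carrier) → Σ f * c ≈ Σ (λ i → f i * c)
    *-distribʳ-Σ c f = begin
      Σ f * c             ≈⟨ *-congʳ (Σ≈sum f) ⟩
      sum f * c           ≈⟨ *-distribʳ-sum c f ⟩
      sum (λ i → f i * c) ≈⟨ Σ≈sum _ ⟨
      Σ (λ i → f i * c)   ∎

    Σ-neg : ∀ {n} (f : Fin n → Carrier) → Σ (λ i → - f i) ≈ - Σ f
    Σ-neg f = begin
      Σ (λ i → - f i)      ≈⟨ Σ-cong (λ i → -1*x≈-x (f i)) ⟨
      Σ (λ i → - 1# * f i) ≈⟨ *-distribˡ-Σ (- 1#) f ⟨
      - 1# * Σ f           ≈⟨ -1*x≈-x (Σ f) ⟩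
      - Σ f                ∎

    Σ-distrib-- : ∀ {n} (f g : Fin n → Carrier) → Σ (λ i → f i - g i) ≈ Σ f - Σ g
    Σ-distrib-- f g = trans (Σ-distrib-+ f (λ i → - g i)) (+-congˡ (Σ-neg g))

    Σ-comm : ∀ {m n} (f : Fin m → Fin n → Carrier) →
             Σ (λ i → Σ (f i)) ≈ Σ (λ j → Σ (λ i → f i j))
    Σ-comm f = begin
      Σ (λ i → Σ (f i))               ≈⟨ Σ-cong (λ i → Σ≈sum (f i)) ⟩
      Σ (λ i → sum (f i))             ≈⟨ Σ≈sum _ ⟩
      sum (λ i → sum (f i))           ≈⟨ ∑-comm f ⟩
      sum (λ j → sum (λ i → f i j))   ≈⟨ Σ≈sum _ ⟨
      Σ (λ j → sum (λ i → f i j))     ≈⟨ Σ-cong (λ j → Σ≈sum _) ⟨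
      Σ (λ j → Σ (λ i → f i j))       ∎

open ℚ using (ℚ; 0ℚ; 1ℚ; ½; _+_; _*_; -_; _-_; _≤_; _<_)
open ≡
open GroupProperties ℚP.+-0-group using (x∙y⁻¹≈ε⇒x≈y; x≈y⇒x∙y⁻¹≈ε) renaming (∙-cancelˡ to +-cancelˡ)
open RingProperties ℚP.+-*-ring using ([y-z]x≈yx-zx)

module ℕΣ = CommutativeMonoidSum ℕP.+-0-commutativeMonoid
module Σℤ = FinSum.Properties ℤP.+-*-commutativeRing sumℤ (λ _ → refl) (λ _ → refl)
module Σℚ = FinSum.Properties ℚP.+-*-commutativeRing sumℚ (λ _ → refl) (λ _ → refl)

fromℤ : ℤ → ℚ
fromℤ z = z ℚ./ 1

toℚᵘ-fromℤ : ∀ z → ℚ.toℚᵘ (fromℤ z) ℚᵘ.≃ mkℚᵘ z 0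
toℚᵘ-fromℤ z = ℚP.toℚᵘ-fromℚᵘ (mkℚᵘ z 0)

fromℤ-+ : ∀ a b → fromℤ (a ℤ.+ b) ≡ fromℤ a + fromℤ b
fromℤ-+ a b = ℚP.toℚᵘ-injective (begin
  ℚ.toℚᵘ (fromℤ (a ℤ.+ b))                ≈⟨ toℚᵘ-fromℤ (a ℤ.+ b) ⟩
  mkℚᵘ (a ℤ.+ b) 0                         ≈⟨ *≡* (cong (ℤ._* ℤ.1ℤ) a+b≡a*1+b*1) ⟩
  mkℚᵘ a 0 ℚᵘ.+ mkℚᵘ b 0                  ≈⟨ ℚᵘP.+-cong (toℚᵘ-fromℤ a) (toℚᵘ-fromℤ b) ⟨
  ℚ.toℚᵘ (fromℤ a) ℚᵘ.+ ℚ.toℚᵘ (fromℤ b)  ≈⟨ ℚP.toℚᵘ-homo-+ (fromℤ a) (fromℤ b) ⟨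
  ℚ.toℚᵘ (fromℤ a + fromℤ b)              ∎)
  where
  open ℚᵘP.≃-Reasoning
  a+b≡a*1+b*1 : a ℤ.+ b ≡ a ℤ.* ℤ.1ℤ ℤ.+ b ℤ.* ℤ.1ℤ
  a+b≡a*1+b*1 = sym (cong₂ ℤ._+_ (ℤP.*-identityʳ a) (ℤP.*-identityʳ b))

fromℤ-* : ∀ a b → fromℤ (a ℤ.* b) ≡ fromℤ a * fromℤ b
fromℤ-* a b = ℚP.toℚᵘ-injective (begin
  ℚ.toℚᵘ (fromℤ (a ℤ.* b))                ≈⟨ toℚᵘ-fromℤ (a ℤ.* b) ⟩
  mkℚᵘ a 0 ℚᵘ.* mkℚᵘ b 0                  ≈⟨ ℚᵘP.*-cong (toℚᵘ-fromℤ a) (toℚᵘ-fromℤ b) ⟨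
  ℚ.toℚᵘ (fromℤ a) ℚᵘ.* ℚ.toℚᵘ (fromℤ b)  ≈⟨ ℚP.toℚᵘ-homo-* (fromℤ a) (fromℤ b) ⟨
  ℚ.toℚᵘ (fromℤ a * fromℤ b)              ∎)
  where open ℚᵘP.≃-Reasoning

fromℤ-neg : ∀ a → fromℤ (ℤ.- a) ≡ - fromℤ a
fromℤ-neg a = ℚP.toℚᵘ-injective (begin
  ℚ.toℚᵘ (fromℤ (ℤ.- a))  ≈⟨ toℚᵘ-fromℤ (ℤ.- a) ⟩
  ℚᵘ.- mkℚᵘ a 0           ≈⟨ ℚᵘP.-‿cong (toℚᵘ-fromℤ a) ⟨
  ℚᵘ.- ℚ.toℚᵘ (fromℤ a)   ≈⟨ ℚP.toℚᵘ-homo‿- (fromℤ a) ⟨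
  ℚ.toℚᵘ (- fromℤ a)      ∎)
  where open ℚᵘP.≃-Reasoning

fromℤ-- : ∀ a b → fromℤ (a ℤ.- b) ≡ fromℤ a - fromℤ b
fromℤ-- a b = trans (fromℤ-+ a (ℤ.- b)) (cong (fromℤ a +_) (fromℤ-neg b))

fromℤ-injective : ∀ {a b} → fromℤ a ≡ fromℤ b → a ≡ b
fromℤ-injective {a} {b} eq
  with ℚᵘP.≃-trans (ℚᵘP.≃-sym (toℚᵘ-fromℤ a)) (ℚᵘP.≃-trans (ℚP.toℚᵘ-cong eq) (toℚᵘ-fromℤ b))
... | *≡* a*1≡b*1 = trans (sym (ℤP.*-identityʳ a)) (trans a*1≡b*1 (ℤP.*-identityʳ b))

fromℤ-sum : ∀ {n} (f : Fin n → ℤ) → fromℤ (sumℤ f) ≡ sumℚ (fromℤ ∘ f)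
fromℤ-sum {zero} f = refl
fromℤ-sum {suc n} f = trans (fromℤ-+ (f zero) _) (cong (fromℤ (f zero) +_) (fromℤ-sum (f ∘ suc)))

bit : Bool → ℚ
bit false = 0ℚ
bit true  = 1ℚ

bit-unit : ∀ x → 0ℚ ≤ bit x × bit x ≤ 1ℚ
bit-unit false = ℚP.≤-refl , ℚP.nonNegative⁻¹ 1ℚ
bit-unit true  = ℚP.nonNegative⁻¹ 1ℚ , ℚP.≤-refl

⁅_⁆ : ∀ {n} → Fin n → Fin n → Bool
⁅ t ⁆ m = does (m ≟ t)

⁅⁆-self : ∀ {n} (t : Fin n) → ⁅ t ⁆ t ≡ true
⁅⁆-self t = dec-true (t ≟ t) refl

⁅⁆-other : ∀ {n} {t m : Fin n} → m ≢ t → ⁅ t ⁆ m ≡ false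
⁅⁆-other {t = t} {m} = dec-false (m ≟ t)

Σ-⁅⁆ : ∀ {n} t (f : Fin n → ℚ) → sumℚ (λ m → bit (⁅ t ⁆ m) * f m) ≡ f t
Σ-⁅⁆ t f = begin
  sumℚ (λ m → bit (⁅ t ⁆ m) * f m)  ≡⟨ Σℚ.Σ-single t others≡0 ⟩
  bit (⁅ t ⁆ t) * f t               ≡⟨ cong (λ x → bit x * f t) (⁅⁆-self t) ⟩
  1ℚ * f t                          ≡⟨ ℚP.*-identityˡ (f t) ⟩
  f t                               ∎
  where
  open ≡-Reasoning
  others≡0 : ∀ m → m ≢ t → bit (⁅ t ⁆ m) * f m ≡ 0ℚ
  others≡0 m m≢t = trans (cong (λ x → bit x * f m) (⁅⁆-other m≢t)) (ℚP.*-zeroˡ (f m))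

sumℚ-mono-≤ : ∀ {N} {f g : Fin N → ℚ} → (∀ k → f k ≤ g k) → sumℚ f ≤ sumℚ g
sumℚ-mono-≤ {zero} _ = ℚP.≤-refl
sumℚ-mono-≤ {suc N} f≤g = ℚP.+-mono-≤ (f≤g zero) (sumℚ-mono-≤ (f≤g ∘ suc))

convex-line : ∀ {N} (c s : Fin N → ℚ) → sumℚ c ≡ 1ℚ → ∀ x d →
              sumℚ (λ k → c k * (x + s k * d)) ≡ x + sumℚ (λ k → c k * s k) * d
convex-line c s Σc≡1 x d = begin
  sumℚ (λ k → c k * (x + s k * d))
    ≡⟨ Σℚ.Σ-cong distribute ⟩
  sumℚ (λ k → c k * x + c k * s k * d)
    ≡⟨ Σℚ.Σ-distrib-+ (λ k → c k * x) (λ k → c k * s k * d) ⟩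
  sumℚ (λ k → c k * x) + sumℚ (λ k → c k * s k * d)
    ≡⟨ cong₂ _+_ Σcx≡x (sym (Σℚ.*-distribʳ-Σ d (λ k → c k * s k))) ⟩
  x + sumℚ (λ k → c k * s k) * d ∎
  where
  open ≡-Reasoning
  distribute : ∀ k → c k * (x + s k * d) ≡ c k * x + c k * s k * d
  distribute k = trans (ℚP.*-distribˡ-+ (c k) x (s k * d)) (cong (c k * x +_) (sym (ℚP.*-assoc (c k) (s k) d)))
  Σcx≡x : sumℚ (λ k → c k * x) ≡ x
  Σcx≡x = trans (sym (Σℚ.*-distribʳ-Σ x c)) (trans (cong (_* x) Σc≡1) (ℚP.*-identityˡ x))

unit-product : ∀ {s t} → 0ℚ ≤ s × s ≤ 1ℚ → 0ℚ ≤ t × t ≤ 1ℚ → s * t ≡ 1ℚ → t ≡ 1ℚ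
unit-product {s} {t} (_ , s≤1) (t≥0 , t≤1) st≡1 = ℚP.≤-antisym t≤1 (begin
  1ℚ      ≡⟨ st≡1 ⟨
  s * t   ≤⟨ ℚP.*-monoʳ-≤-nonNeg t {{ℚ.nonNegative t≥0}} s≤1 ⟩
  1ℚ * t  ≡⟨ ℚP.*-identityˡ t ⟩
  t       ∎)
  where open ℚP.≤-Reasoning

unit-complement : ∀ {t} → 0ℚ ≤ t × t ≤ 1ℚ → 0ℚ ≤ 1ℚ - t × 1ℚ - t ≤ 1ℚ
unit-complement {t} (t≥0 , t≤1) =
  ℚP.≤-trans (ℚP.≤-reflexive (sym (ℚP.+-inverseʳ t))) (ℚP.+-monoˡ-≤ (- t) t≤1) ,
  ℚP.≤-trans (ℚP.+-monoʳ-≤ 1ℚ (ℚP.neg-antimono-≤ t≥0)) (ℚP.≤-reflexive (ℚP.+-identityʳ 1ℚ))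

opposite-endpoint : ∀ x {s y} → 0ℚ ≤ s × s ≤ 1ℚ → 0ℚ ≤ y × y ≤ 1ℚ →
                    bit (not x) ≡ bit x + s * (y - bit x) → y ≡ bit (not x)
opposite-endpoint false {s} {y} s∈ y∈ eq = unit-product s∈ y∈ (begin
  s * y              ≡⟨ solve 2 (λ s y → s :* y := con 0ℚ :+ s :* (y :- con 0ℚ)) refl s y ⟩
  0ℚ + s * (y - 0ℚ)  ≡⟨ eq ⟨
  1ℚ                 ∎)
  where
  open ≡-Reasoning
  open ℚ-Solver
opposite-endpoint true {s} {y} s∈ y∈ eq = begin
  y              ≡⟨ solve 1 (λ y → y := con 1ℚ :- (con 1ℚ :- y)) refl y ⟩
  1ℚ - (1ℚ - y)  ≡⟨ cong (λ q → 1ℚ - q) (unit-product s∈ (unit-complement y∈) s[1-y]≡1) ⟩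
  0ℚ             ∎
  where
  open ≡-Reasoning
  open ℚ-Solver
  s[1-y]≡1 : s * (1ℚ - y) ≡ 1ℚ
  s[1-y]≡1 = begin
    s * (1ℚ - y)
      ≡⟨ solve 2 (λ s y → s :* (con 1ℚ :- y) := con 1ℚ :- (con 1ℚ :+ s :* (y :- con 1ℚ))) refl s y ⟩
    1ℚ - (1ℚ + s * (y - 1ℚ))
      ≡⟨ cong (λ q → 1ℚ - q) eq ⟨
    1ℚ ∎

no-second-step : ∀ x {q y} → q ≡ bit (not x) →
                 0ℚ ≤ bit x + ((q - bit x) + (y - bit x)) × bit x + ((q - bit x) + (y - bit x)) ≤ 1ℚ →
                 0ℚ ≤ y × y ≤ 1ℚ → y ≡ bit x
no-second-step false {y = y} refl (_ , upper) (y≥0 , _) = ℚP.≤-antisym (begin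
  y                                    ≡⟨ solve 1 (λ y → y := (con 0ℚ :+ ((con 1ℚ :- con 0ℚ) :+ (y :- con 0ℚ))) :- con 1ℚ)
                                                  refl y ⟩
  (0ℚ + ((1ℚ - 0ℚ) + (y - 0ℚ))) - 1ℚ  ≤⟨ ℚP.+-monoˡ-≤ (- 1ℚ) upper ⟩
  1ℚ - 1ℚ                              ≡⟨⟩
  0ℚ                                   ∎) y≥0
  where
  open ℚP.≤-Reasoning
  open ℚ-Solver
no-second-step true {y = y} refl (lower , _) (_ , y≤1) = ℚP.≤-antisym y≤1 (begin
  1ℚ                                   ≡⟨⟩
  0ℚ + 1ℚ                              ≤⟨ ℚP.+-monoˡ-≤ 1ℚ lower ⟩
  (1ℚ + ((0ℚ - 1ℚ) + (y - 1ℚ))) + 1ℚ  ≡⟨ solve 1 (λ y → (con 1ℚ :+ ((con 0ℚ :- con 1ℚ) :+ (y :- con 1ℚ))) :+ con 1ℚ := y)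
                                                  refl y ⟩
  y                                    ∎)
  where
  open ℚP.≤-Reasoning
  open ℚ-Solver

-- Affine maps of ℚⁿ

lin : ∀ {m n} → (Fin m → Fin n → ℚ) → (Fin m → ℚ) → Fin n → ℚ
lin V γ j = sumℚ (λ k → γ k * V k j)

affine : ∀ {m n} → (Fin m → Fin n → ℚ) → (Fin n → ℚ) → (Fin m → ℚ) → Fin n → ℚ
affine V o γ j = o j + lin V γ j

module _ {m n} (V : Fin m → Fin n → ℚ) where

  lin-cong : ∀ {γ δ} → γ ≗ δ → lin V γ ≗ lin V δ
  lin-cong γ≗δ j = Σℚ.Σ-cong (λ k → cong (_* V k j) (γ≗δ k))

  lin-- : ∀ γ δ j → lin V (λ k → γ k - δ k) j ≡ lin V γ j - lin V δ j
  lin-- γ δ j = trans (Σℚ.Σ-cong (λ k → [y-z]x≈yx-zx (V k j) (γ k) (δ k)))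
                      (Σℚ.Σ-distrib-- (λ k → γ k * V k j) (λ k → δ k * V k j))

  lin-+ : ∀ γ δ j → lin V (λ k → γ k + δ k) j ≡ lin V γ j + lin V δ j
  lin-+ γ δ j = trans (Σℚ.Σ-cong (λ k → ℚP.*-distribʳ-+ (V k j) (γ k) (δ k)))
                      (Σℚ.Σ-distrib-+ (λ k → γ k * V k j) (λ k → δ k * V k j))

  lin-Σ : ∀ {N} (c : Fin N → ℚ) (γ : Fin N → Fin m → ℚ) j →
          lin V (λ k → sumℚ (λ t → c t * γ t k)) j ≡ sumℚ (λ t → c t * lin V (γ t) j)
  lin-Σ c γ j = begin
    sumℚ (λ k → sumℚ (λ t → c t * γ t k) * V k j)
      ≡⟨ Σℚ.Σ-cong (λ k → Σℚ.*-distribʳ-Σ (V k j) (λ t → c t * γ t k)) ⟩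
    sumℚ (λ k → sumℚ (λ t → c t * γ t k * V k j))
      ≡⟨ Σℚ.Σ-comm (λ k t → c t * γ t k * V k j) ⟩
    sumℚ (λ t → sumℚ (λ k → c t * γ t k * V k j))
      ≡⟨ Σℚ.Σ-cong (λ t → Σℚ.Σ-cong (λ k → ℚP.*-assoc (c t) (γ t k) (V k j))) ⟩
    sumℚ (λ t → sumℚ (λ k → c t * (γ t k * V k j)))
      ≡⟨ Σℚ.Σ-cong (λ t → Σℚ.*-distribˡ-Σ (c t) (λ k → γ t k * V k j)) ⟨
    sumℚ (λ t → c t * lin V (γ t) j) ∎
    where open ≡-Reasoning

  affine-cong : ∀ o {γ δ} → γ ≗ δ → affine V o γ ≗ affine V o δ
  affine-cong o γ≗δ j = cong (o j +_) (lin-cong γ≗δ j)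

  affine-combination : ∀ o x {N} (c : Fin N → ℚ) (y : Fin N → Fin m → ℚ) j →
    affine V o (λ k → x k + sumℚ (λ t → c t * (y t k - x k))) j ≡
    affine V o x j + sumℚ (λ t → c t * (affine V o (y t) j - affine V o x j))
  affine-combination o x c y j = begin
    o j + lin V (λ k → x k + sumℚ (λ t → c t * (y t k - x k))) j
      ≡⟨ cong (o j +_) (trans (lin-+ x _ j) (cong (lin V x j +_) (lin-Σ c _ j))) ⟩
    o j + (lin V x j + sumℚ (λ t → c t * lin V (λ k → y t k - x k) j))
      ≡⟨ ℚP.+-assoc (o j) _ _ ⟨
    affine V o x j + sumℚ (λ t → c t * lin V (λ k → y t k - x k) j)
      ≡⟨ cong (affine V o x j +_) (Σℚ.Σ-cong (λ t → cong (c t *_) (difference t))) ⟩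
    affine V o x j + sumℚ (λ t → c t * (affine V o (y t) j - affine V o x j)) ∎
    where
    open ≡-Reasoning
    difference : ∀ t → lin V (λ k → y t k - x k) j ≡ affine V o (y t) j - affine V o x j
    difference t = trans (lin-- (y t) x j)
      (ℚ-Solver.solve 3 (λ a p q → p :- q := (a :+ p) :- (a :+ q)) refl (o j) (lin V (y t) j) (lin V x j))
      where open ℚ-Solver

  affine-convex : ∀ o {N} (c : Fin N → ℚ) → sumℚ c ≡ 1ℚ → ∀ (γ : Fin N → Fin m → ℚ) j →
    sumℚ (λ t → c t * affine V o (γ t) j) ≡ affine V o (λ k → sumℚ (λ t → c t * γ t k)) j
  affine-convex o c Σc≡1 γ j = begin
    sumℚ (λ t → c t * (o j + lin V (γ t) j))
      ≡⟨ Σℚ.Σ-cong (λ t → ℚP.*-distribˡ-+ (c t) _ _) ⟩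
    sumℚ (λ t → c t * o j + c t * lin V (γ t) j)
      ≡⟨ Σℚ.Σ-distrib-+ (λ t → c t * o j) (λ t → c t * lin V (γ t) j) ⟩
    sumℚ (λ t → c t * o j) + sumℚ (λ t → c t * lin V (γ t) j)
      ≡⟨ cong₂ _+_ Σco≡o (sym (lin-Σ c γ j)) ⟩
    o j + lin V (λ k → sumℚ (λ t → c t * γ t k)) j ∎
    where
    open ≡-Reasoning
    Σco≡o : sumℚ (λ t → c t * o j) ≡ o j
    Σco≡o = trans (sym (Σℚ.*-distribʳ-Σ (o j) c)) (trans (cong (_* o j) Σc≡1) (ℚP.*-identityˡ (o j)))

  affine-basis : ∀ o γ j →
    affine V o γ j ≡ affine V o (λ _ → 0ℚ) j + sumℚ (λ t → γ t * (affine V o (bit ∘ ⁅ t ⁆) j - affine V o (λ _ → 0ℚ) j))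
  affine-basis o γ j = begin
    o j + lin V γ j
      ≡⟨ cong (_+ lin V γ j) (trans (cong (o j +_) lin-0) (ℚP.+-identityʳ (o j))) ⟨
    affine V o (λ _ → 0ℚ) j + lin V γ j
      ≡⟨ cong (affine V o (λ _ → 0ℚ) j +_) (Σℚ.Σ-cong (λ t → cong (γ t *_) edge)) ⟩
    affine V o (λ _ → 0ℚ) j + sumℚ (λ t → γ t * (affine V o (bit ∘ ⁅ t ⁆) j - affine V o (λ _ → 0ℚ) j)) ∎
    where
    open ≡-Reasoning
    lin-0 : lin V (λ _ → 0ℚ) j ≡ 0ℚ
    lin-0 = Σℚ.Σ-zeros (λ k → ℚP.*-zeroˡ (V k j))
    edge : ∀ {t} → V t j ≡ affine V o (bit ∘ ⁅ t ⁆) j - affine V o (λ _ → 0ℚ) j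
    edge {t} = sym (begin
      (o j + lin V (bit ∘ ⁅ t ⁆) j) - (o j + lin V (λ _ → 0ℚ) j)
        ≡⟨ cong₂ (λ p q → (o j + p) - (o j + q)) (Σ-⁅⁆ t (λ k → V k j)) lin-0 ⟩
      (o j + V t j) - (o j + 0ℚ)
        ≡⟨ ℚ-Solver.solve 2 (λ a p → (a :+ p) :- (a :+ con 0ℚ) := p) refl (o j) (V t j) ⟩
      V t j ∎)
      where open ℚ-Solver

-- Faces and flags of the cube

Fits : Pat → Bool → Set
Fits fix0 x = x ≡ false
Fits fix1 x = x ≡ true
Fits free _ = ⊤

VertexOf : ∀ {n} → Face n → (Fin n → Bool) → Set
VertexOf f β = ∀ m → Fits (f m) (β m)

InPat : Pat → ℚ → Set
InPat fix0 x = x ≡ 0ℚ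
InPat fix1 x = x ≡ 1ℚ
InPat free x = 0ℚ ≤ x × x ≤ 1ℚ

InFace : ∀ {n} → Face n → (Fin n → ℚ) → Set
InFace f γ = ∀ m → InPat (f m) (γ m)

Fits⇒InPat : ∀ p {x} → Fits p x → InPat p (bit x)
Fits⇒InPat fix0 refl = refl
Fits⇒InPat fix1 refl = refl
Fits⇒InPat free {x} _ = bit-unit x

InPat-convex : ∀ p {N} (c s : Fin N → ℚ) → (∀ k → 0ℚ ≤ c k) → sumℚ c ≡ 1ℚ →
               (∀ k → InPat p (s k)) → InPat p (sumℚ (λ k → c k * s k))
InPat-convex fix0 c s _ _ s≡0 = Σℚ.Σ-zeros (λ k → trans (cong (c k *_) (s≡0 k)) (ℚP.*-zeroʳ (c k)))
InPat-convex fix1 c s _ Σc≡1 s≡1 =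
  trans (Σℚ.Σ-cong (λ k → trans (cong (c k *_) (s≡1 k)) (ℚP.*-identityʳ (c k)))) Σc≡1
InPat-convex free {N} c s c≥0 Σc≡1 s∈ =
  ℚP.≤-trans (ℚP.≤-reflexive (sym (Σℚ.Σ-zeros {N} {λ k → 0ℚ * s k} (λ k → ℚP.*-zeroˡ (s k))))) (sumℚ-mono-≤ lower) ,
  ℚP.≤-trans (sumℚ-mono-≤ upper) (ℚP.≤-reflexive Σc≡1)
  where
  lower : ∀ k → 0ℚ * s k ≤ c k * s k
  lower k = ℚP.*-monoʳ-≤-nonNeg (s k) {{ℚ.nonNegative (proj₁ (s∈ k))}} (c≥0 k)
  upper : ∀ k → c k * s k ≤ c k
  upper k = ℚP.≤-trans (ℚP.*-monoˡ-≤-nonNeg (c k) {{ℚ.nonNegative (c≥0 k)}} (proj₂ (s∈ k)))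
                       (ℚP.≤-reflexive (ℚP.*-identityʳ (c k)))

VertexOf-consB : ∀ {n} {f : Face (suc n)} {x β} → Fits (f zero) x → VertexOf (f ∘ suc) β →
                 VertexOf f (consB x β)
VertexOf-consB fx _ zero = fx
VertexOf-consB _ vβ (suc m) = vβ m

consB-vertices : ∀ {n} {f : Face (suc n)} {x L} → Fits (f zero) x → All (VertexOf (f ∘ suc)) L →
                 All (VertexOf f) (map (consB x) L)
consB-vertices fx = All.map⁺ ∘ All.map (VertexOf-consB fx)

faceBools-sound : ∀ {n} (f : Face n) → All (VertexOf f) (faceBools f)
faceBools-sound {zero} f = (λ ()) All.∷ All.[]
faceBools-sound {suc n} f with f zero in f0
... | fix0 = consB-vertices (subst (λ p → Fits p false) (sym f0) refl) (faceBools-sound (f ∘ suc))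
... | fix1 = consB-vertices (subst (λ p → Fits p true) (sym f0) refl) (faceBools-sound (f ∘ suc))
... | free = All.++⁺ (consB-vertices (subst (λ p → Fits p false) (sym f0) tt) (faceBools-sound (f ∘ suc)))
                     (consB-vertices (subst (λ p → Fits p true) (sym f0) tt) (faceBools-sound (f ∘ suc)))

consB-member : ∀ {n x L} {β : Fin (suc n) → Bool} → x ≡ β zero → Any (_≗ β ∘ suc) L →
               Any (_≗ β) (map (consB x) L)
consB-member x≡β0 = Any.map⁺ ∘ Any.map (λ β′≗β → λ { zero → x≡β0 ; (suc m) → β′≗β m })

faceBools-complete : ∀ {n} (f : Face n) {β} → VertexOf f β → Any (_≗ β) (faceBools f)
faceBools-complete {zero} f _ = here (λ ())
faceBools-complete {suc n} f {β} vβ with f zero | vβ zero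
... | fix0 | β0 = consB-member (sym β0) (faceBools-complete (f ∘ suc) (vβ ∘ suc))
... | fix1 | β0 = consB-member (sym β0) (faceBools-complete (f ∘ suc) (vβ ∘ suc))
... | free | _ with β zero in β0
...   | false = Any.++⁺ˡ (consB-member (sym β0) (faceBools-complete (f ∘ suc) (vβ ∘ suc)))
...   | true  = Any.++⁺ʳ _ (consB-member (sym β0) (faceBools-complete (f ∘ suc) (vβ ∘ suc)))

fixB : Bool → Pat
fixB false = fix0
fixB true  = fix1

Fits-fixB : ∀ {x y} → y ≡ x → Fits (fixB x) y
Fits-fixB {false} y≡x = y≡x
Fits-fixB {true}  y≡x = y≡x

Fits-fixB⁻ : ∀ {x y} → Fits (fixB x) y → y ≡ x
Fits-fixB⁻ {false} fits = fits
Fits-fixB⁻ {true}  fits = fits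

InPat-fixB⁻ : ∀ {x q} → InPat (fixB x) q → q ≡ bit x
InPat-fixB⁻ {false} q∈ = q∈
InPat-fixB⁻ {true}  q∈ = q∈

flagFace : ∀ {n} → Permutation′ n → (Fin n → Bool) → Fin (suc n) → Face n
flagFace π base k m = if does (toℕ (π ⟨$⟩ʳ m) ℕP.<? toℕ k) then free else fixB (base m)

module _ {n} (π : Permutation′ n) (base : Fin n → Bool) where

  flagFace-free : ∀ {k m} → toℕ (π ⟨$⟩ʳ m) ℕ.< toℕ k → flagFace π base k m ≡ free
  flagFace-free {k} {m} h = cong (λ c → if c then free else fixB (base m)) (dec-true (_ ℕP.<? toℕ k) h)

  flagFace-fixed : ∀ {k m} → toℕ k ℕ.≤ toℕ (π ⟨$⟩ʳ m) → flagFace π base k m ≡ fixB (base m)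
  flagFace-fixed {k} {m} h =
    cong (λ c → if c then free else fixB (base m)) (dec-false (_ ℕP.<? toℕ k) (ℕP.≤⇒≯ h))

  flagFace-⊆ : ∀ k → flagFace π base (inject₁ k) ⊆F flagFace π base (suc k)
  flagFace-⊆ k m with toℕ (π ⟨$⟩ʳ m) ℕP.<? suc (toℕ k)
  ... | yes below = inj₁ (flagFace-free below)
  ... | no ¬below = inj₂ (trans (flagFace-fixed k<rank) (sym (flagFace-fixed k≤rank)))
    where
    k<rank : suc (toℕ k) ℕ.≤ toℕ (π ⟨$⟩ʳ m)
    k<rank = ℕP.≮⇒≥ ¬below
    k≤rank : toℕ (inject₁ k) ℕ.≤ toℕ (π ⟨$⟩ʳ m)
    k≤rank = subst (ℕ._≤ _) (sym (toℕ-inject₁ k)) (ℕP.<⇒≤ k<rank)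

  VertexOf-flagFace : ∀ {k β} → (∀ m → toℕ k ℕ.≤ toℕ (π ⟨$⟩ʳ m) → β m ≡ base m) →
                      VertexOf (flagFace π base k) β
  VertexOf-flagFace {k} {β} agree m with toℕ (π ⟨$⟩ʳ m) ℕP.<? toℕ k
  ... | yes below = subst (λ p → Fits p (β m)) (sym (flagFace-free below)) tt
  ... | no ¬below = subst (λ p → Fits p (β m)) (sym (flagFace-fixed (ℕP.≮⇒≥ ¬below)))
                          (Fits-fixB (agree m (ℕP.≮⇒≥ ¬below)))

  VertexOf-flagFace⁻ : ∀ {k β m} → VertexOf (flagFace π base k) β → toℕ k ℕ.≤ toℕ (π ⟨$⟩ʳ m) →
                       β m ≡ base m
  VertexOf-flagFace⁻ {β = β} {m} vβ fixed =
    Fits-fixB⁻ (subst (λ p → Fits p (β m)) (flagFace-fixed fixed) (vβ m))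

  InFace-flagFace⁻ : ∀ {k γ m} → InFace (flagFace π base k) γ → toℕ k ℕ.≤ toℕ (π ⟨$⟩ʳ m) →
                     γ m ≡ bit (base m)
  InFace-flagFace⁻ {γ = γ} {m} γ∈ fixed =
    InPat-fixB⁻ (subst (λ p → InPat p (γ m)) (flagFace-fixed fixed) (γ∈ m))

rank-positive : ∀ {n} (π : Permutation′ (suc n)) {t m} → π ⟨$⟩ʳ t ≡ zero → m ≢ t → 1 ℕ.≤ toℕ (π ⟨$⟩ʳ m)
rank-positive π {t} {m} πt≡0 m≢t with π ⟨$⟩ʳ m in πm
... | zero  = ⊥-elim (m≢t (Injection.injective (↔⇒↣ π) (trans πm (sym πt≡0))))
... | suc _ = ℕ.s≤s ℕ.z≤n

transpose-first : ∀ {n} (t : Fin (suc n)) → Perm.transpose t zero ⟨$⟩ʳ t ≡ zero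
transpose-first t rewrite dec-true (t ≟ t) refl = refl

isFree : Pat → ℕ
isFree free = 1
isFree fix0 = 0
isFree fix1 = 0

dimF≡sum : ∀ {n} (f : Face n) → dimF f ≡ ℕΣ.sum (isFree ∘ f)
dimF≡sum {zero} f = refl
dimF≡sum {suc n} f with f zero
... | free = cong suc (dimF≡sum (f ∘ suc))
... | fix0 = dimF≡sum (f ∘ suc)
... | fix1 = dimF≡sum (f ∘ suc)

count-free-below : ∀ n K → ℕΣ.sum {n} (λ m → isFree (if does (toℕ m ℕP.<? K) then free else fix0)) ≡ K ⊓ n
count-free-below zero K = sym (ℕP.⊓-zeroʳ K)
count-free-below (suc n) zero = count-free-below n zero
count-free-below (suc n) (suc K) = cong suc (count-free-below n K)

isFree-fixB : ∀ c x → isFree (if c then free else fixB x) ≡ isFree (if c then free else fix0)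
isFree-fixB true  _     = refl
isFree-fixB false false = refl
isFree-fixB false true  = refl

dim-flagFace : ∀ {n} (π : Permutation′ n) base (k : Fin (suc n)) → dimF (flagFace π base k) ≡ toℕ k
dim-flagFace {n} π base k = begin
  dimF (flagFace π base k)             ≡⟨ dimF≡sum (flagFace π base k) ⟩
  ℕΣ.sum (isFree ∘ flagFace π base k)  ≡⟨ ℕΣ.sum-cong-≗ (λ m → isFree-fixB _ (base m)) ⟩
  ℕΣ.sum (λ m → freeBelow (π ⟨$⟩ʳ m))  ≡⟨ ℕΣ.∑-permute freeBelow π ⟨
  ℕΣ.sum freeBelow                     ≡⟨ count-free-below n (toℕ k) ⟩
  toℕ k ⊓ n                            ≡⟨ ℕP.m≤n⇒m⊓n≡m (toℕ≤pred[n] k) ⟩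
  toℕ k                                ∎
  where
  open ≡-Reasoning
  freeBelow : Fin n → ℕ
  freeBelow m = isFree (if does (toℕ m ℕP.<? toℕ k) then free else fix0)

permFlag : ∀ {n} → Permutation′ n → (Fin n → Bool) → Flag n
permFlag π base = record { F = flagFace π base ; dimOK = dim-flagFace π base ; chain = flagFace-⊆ π base }

All-lookup : ∀ {A : Set} {P : A → Set} {xs : List A} → All P xs → ∀ k → P (lookup xs k)
All-lookup all k = All.lookup all (∈-lookup k)

module _ {n : ℕ} where

  InHull-cong : ∀ {ys : List (QPt n)} {x y} → InHull ys x → x ≗ y → InHull ys y
  InHull-cong (c , c≥0 , Σc≡1 , combo) x≗y = c , c≥0 , Σc≡1 , λ j → trans (combo j) (x≗y j)

  InHull-member : ∀ {ys : List (QPt n)} {x} → Any (_≗ x) ys → InHull ys x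
  InHull-member {y ∷ ys} (here y≗x) =
    (λ { zero → 1ℚ ; (suc _) → 0ℚ }) ,
    (λ { zero → bit-unit true .proj₁ ; (suc _) → ℚP.≤-refl }) ,
    cong (1ℚ +_) (Σℚ.Σ-zeros {length ys} (λ _ → refl)) ,
    λ j → begin
      1ℚ * y j + sumℚ (λ k → 0ℚ * lookup ys k j)
        ≡⟨ cong₂ _+_ (ℚP.*-identityˡ (y j)) (Σℚ.Σ-zeros (λ k → ℚP.*-zeroˡ (lookup ys k j))) ⟩
      y j + 0ℚ ≡⟨ ℚP.+-identityʳ (y j) ⟩
      y j      ≡⟨ y≗x j ⟩
      _        ∎
    where open ≡-Reasoning
  InHull-member {y ∷ ys} (there x∈ys) with InHull-member x∈ys
  ... | c , c≥0 , Σc≡1 , combo =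
    (λ { zero → 0ℚ ; (suc k) → c k }) ,
    (λ { zero → ℚP.≤-refl ; (suc k) → c≥0 k }) ,
    trans (ℚP.+-identityˡ (sumℚ c)) Σc≡1 ,
    λ j → trans (cong (_+ sumℚ (λ k → c k * lookup ys k j)) (ℚP.*-zeroˡ (y j))) (trans (ℚP.+-identityˡ _) (combo j))

  InHull-generator : ∀ {xs ys : List (QPt n)} {x} → (∀ k → InHull ys (lookup xs k)) → Any (_≗ x) xs →
                     InHull ys x
  InHull-generator {ys = ys} xs⊆ys x∈xs = InHull-cong {ys = ys} (xs⊆ys (Any.index x∈xs)) (Any.lookup-index x∈xs)

SameHull-map : ∀ {n} {B : Set} {h h′ : B → QPt n} (L : List B) → (∀ β → h β ≗ h′ β) →
               SameHull (map h L) (map h′ L)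
SameHull-map {h = h} {h′} L h≗h′ =
  (λ k → InHull-member {ys = map h′ L} (matching L (λ β j → sym (h≗h′ β j)) k)) ,
  (λ k → InHull-member {ys = map h L} (matching L h≗h′ k))
  where
  matching : ∀ {g g′} L → (∀ β → g′ β ≗ g β) → ∀ k → Any (_≗ lookup (map g L) k) (map g′ L)
  matching (β ∷ L) g′≗g zero    = here (g′≗g β)
  matching (β ∷ L) g′≗g (suc k) = there (matching L g′≗g k)

-- Cube coordinates

apply-cong : ∀ {n} (T : LatAff n) {x y : Pt n} → x ≗ y → apply T x ≗ apply T y
apply-cong T x≗y j = cong (ℤ._+ LatAff.b T j) (Σℤ.Σ-cong (λ k → cong (LatAff.M T j k ℤ.*_) (x≗y k)))

module Frame {n} (A : Pt n) (v : Fin n → Pt n) where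

  edges : Fin n → Fin n → ℚ
  edges m = toQ (v m)

  point : (Fin n → ℚ) → QPt n
  point = affine edges (toQ A)

  Coords : QPt n → (Fin n → ℚ) → Set
  Coords x γ = x ≗ point γ

  Coords-cong : ∀ {x γ δ} → Coords x γ → γ ≗ δ → Coords x δ
  Coords-cong x≗γ γ≗δ j = trans (x≗γ j) (affine-cong edges (toQ A) γ≗δ j)

  coords-unique : LinIndep v → ∀ {x γ δ} → Coords x γ → Coords x δ → γ ≗ δ
  coords-unique independent {x} {γ} {δ} x≗γ x≗δ m =
    x∙y⁻¹≈ε⇒x≈y (γ m) (δ m) (independent (λ k → γ k - δ k) lin≡0 m)
    where
    lin≡0 : ∀ j → lin edges (λ k → γ k - δ k) j ≡ 0ℚ
    lin≡0 j = trans (lin-- edges γ δ j) (x≈y⇒x∙y⁻¹≈ε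
                (+-cancelˡ (toQ A j) (lin edges γ j) (lin edges δ j) (trans (sym (x≗γ j)) (x≗δ j))))

  vertex-coords : ∀ β → Coords (toQ (vertex A v β)) (bit ∘ β)
  vertex-coords β j = begin
    fromℤ (A j ℤ.+ sumℤ (λ i → if β i then v i j else ℤ.0ℤ))
      ≡⟨ fromℤ-+ (A j) _ ⟩
    toQ A j + fromℤ (sumℤ (λ i → if β i then v i j else ℤ.0ℤ))
      ≡⟨ cong (toQ A j +_) (trans (fromℤ-sum (λ i → if β i then v i j else ℤ.0ℤ))
                                  (Σℚ.Σ-cong (λ i → fromℤ-if (β i) (v i j)))) ⟩
    point (bit ∘ β) j ∎
    where
    open ≡-Reasoning
    fromℤ-if : ∀ x z → fromℤ (if x then z else ℤ.0ℤ) ≡ bit x * fromℤ z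
    fromℤ-if false z = sym (ℚP.*-zeroˡ (fromℤ z))
    fromℤ-if true  z = sym (ℚP.*-identityˡ (fromℤ z))

  Coords-shift : ∀ {x y γ δ} → Coords (toQ x) γ → Coords (toQ y) δ →
                 Coords (toQ (λ k → x k ℤ.- y k ℤ.+ A k)) (λ m → γ m - δ m)
  Coords-shift {x} {y} {γ} {δ} x≗γ y≗δ j = begin
    fromℤ (x j ℤ.- y j ℤ.+ A j)
      ≡⟨ trans (fromℤ-+ (x j ℤ.- y j) (A j)) (cong (_+ toQ A j) (fromℤ-- (x j) (y j))) ⟩
    toQ x j - toQ y j + toQ A j
      ≡⟨ cong₂ (λ p q → p - q + toQ A j) (x≗γ j) (y≗δ j) ⟩
    (toQ A j + lin edges γ j) - (toQ A j + lin edges δ j) + toQ A j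
      ≡⟨ solve 3 (λ a p q → (a :+ p) :- (a :+ q) :+ a := a :+ (p :- q)) refl (toQ A j) (lin edges γ j) (lin edges δ j) ⟩
    toQ A j + (lin edges γ j - lin edges δ j)
      ≡⟨ cong (toQ A j +_) (lin-- edges γ δ j) ⟨
    point (λ m → γ m - δ m) j ∎
    where
    open ≡-Reasoning
    open ℚ-Solver

  Coords-edge : ∀ {x t r} → Coords x (λ m → bit (⁅ t ⁆ m) * r) → ∀ k → x k - toQ A k ≡ r * toQ (v t) k
  Coords-edge {x} {t} {r} x≗ k = begin
    x k - toQ A k
      ≡⟨ cong (_- toQ A k) (x≗ k) ⟩
    toQ A k + lin edges (λ m → bit (⁅ t ⁆ m) * r) k - toQ A k
      ≡⟨ solve 2 (λ a p → a :+ p :- a := p) refl (toQ A k) _ ⟩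
    lin edges (λ m → bit (⁅ t ⁆ m) * r) k
      ≡⟨ Σℚ.Σ-cong (λ m → ℚP.*-assoc (bit (⁅ t ⁆ m)) r (toQ (v m) k)) ⟩
    sumℚ (λ m → bit (⁅ t ⁆ m) * (r * toQ (v m) k))
      ≡⟨ Σ-⁅⁆ t (λ m → r * toQ (v m) k) ⟩
    r * toQ (v t) k ∎
    where
    open ≡-Reasoning
    open ℚ-Solver

  hull-coords : ∀ {ys : List (QPt n)} {x} (c : Fin (length ys) → ℚ) → sumℚ c ≡ 1ℚ →
                (∀ j → sumℚ (λ k → c k * lookup ys k j) ≡ x j) →
                (Γ : Fin (length ys) → Fin n → ℚ) → (∀ k → Coords (lookup ys k) (Γ k)) →
                Coords x (λ m → sumℚ (λ k → c k * Γ k m))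
  hull-coords {ys} {x} c Σc≡1 combo Γ gens j = begin
    x j                                       ≡⟨ combo j ⟨
    sumℚ (λ k → c k * lookup ys k j)          ≡⟨ Σℚ.Σ-cong (λ k → cong (c k *_) (gens k j)) ⟩
    sumℚ (λ k → c k * point (Γ k) j)          ≡⟨ affine-convex edges (toQ A) c Σc≡1 Γ j ⟩
    point (λ m → sumℚ (λ k → c k * Γ k m)) j  ∎
    where open ≡-Reasoning

  hull-InFace : ∀ {ys : List (QPt n)} {x} {g : Face n} → InHull ys x →
                All (λ y → ∃ λ γ → Coords y γ × InFace g γ) ys → ∃ λ γ → Coords x γ × InFace g γ
  hull-InFace {ys} {g = g} (c , c≥0 , Σc≡1 , combo) gens =
    _ , hull-coords {ys} c Σc≡1 combo Γ (λ k → proj₁ (proj₂ (All-lookup gens k))) ,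
    λ m → InPat-convex (g m) c (λ k → Γ k m) c≥0 Σc≡1 (λ k → proj₂ (proj₂ (All-lookup gens k)) m)
    where
    Γ : Fin (length ys) → Fin n → ℚ
    Γ k = proj₁ (All-lookup gens k)

  vertex-cong : ∀ {β β′} → β ≗ β′ → vertex A v β ≗ vertex A v β′
  vertex-cong β≗β′ j = cong (λ s → A j ℤ.+ s) (Σℤ.Σ-cong (λ i → cong (λ x → if x then v i j else ℤ.0ℤ) (β≗β′ i)))

  vertices-InFace : ∀ g → All (λ y → ∃ λ γ → Coords y γ × InFace g γ) (faceVerts A v g)
  vertices-InFace g =
    All.map⁺ (All.map (λ {β} vβ → bit ∘ β , vertex-coords β , λ m → Fits⇒InPat (g m) (vβ m)) (faceBools-sound g))

  vertex-member : ∀ {f β} → VertexOf f β → Any (_≗ toQ (vertex A v β)) (faceVerts A v f)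
  vertex-member {f} vβ =
    Any.map⁺ (Any.map (λ β′≗β j → cong fromℤ (vertex-cong β′≗β j)) (faceBools-complete f vβ))

  image-member : ∀ T {f β} → VertexOf f β → Any (_≗ toQ (apply T (vertex A v β))) (imgFaceVerts T A v f)
  image-member T {f} vβ =
    Any.map⁺ (Any.map (λ β′≗β j → cong fromℤ (apply-cong T (vertex-cong β′≗β) j)) (faceBools-complete f vβ))

  image-coords-InFace : ∀ T {f g β} → SameHull (imgFaceVerts T A v f) (faceVerts A v g) → VertexOf f β →
                        ∃ λ γ → Coords (toQ (apply T (vertex A v β))) γ × InFace g γ
  image-coords-InFace T {g = g} (T[f]⊆g , _) vβ = hull-InFace {faceVerts A v g}
    (InHull-generator {ys = faceVerts A v g} T[f]⊆g (image-member T vβ)) (vertices-InFace g)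

module Action {n} (A : Pt n) (v : Fin n → Pt n) (independent : LinIndep v) (T : LatAff n)
              (T-cube : SameHull (imgFaceVerts T A v fullFace) (faceVerts A v fullFace)) where

  open Frame A v

  matrixᵀ : Fin n → Fin n → ℚ
  matrixᵀ k j = fromℤ (LatAff.M T j k)

  Tℚ : QPt n → QPt n
  Tℚ = affine matrixᵀ (toQ (LatAff.b T))

  toQ-apply : ∀ x → toQ (apply T x) ≗ Tℚ (toQ x)
  toQ-apply x j = begin
    fromℤ (sumℤ Mx ℤ.+ LatAff.b T j)        ≡⟨ fromℤ-+ (sumℤ Mx) (LatAff.b T j) ⟩
    fromℤ (sumℤ Mx) + toQ (LatAff.b T) j    ≡⟨ ℚP.+-comm _ (toQ (LatAff.b T) j) ⟩
    toQ (LatAff.b T) j + fromℤ (sumℤ Mx)    ≡⟨ cong (toQ (LatAff.b T) j +_) (trans (fromℤ-sum Mx) (Σℚ.Σ-cong entry)) ⟩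
    Tℚ (toQ x) j                            ∎
    where
    open ≡-Reasoning
    Mx : Fin n → ℤ
    Mx k = LatAff.M T j k ℤ.* x k
    entry : ∀ k → fromℤ (Mx k) ≡ toQ x k * matrixᵀ k j
    entry k = trans (fromℤ-* (LatAff.M T j k) (x k)) (ℚP.*-comm _ (toQ x k))

  image : (Fin n → Bool) → Fin n → ℚ
  image β = proj₁ (image-coords-InFace T {β = β} T-cube (λ _ → tt))

  image-coords : ∀ β → Coords (toQ (apply T (vertex A v β))) (image β)
  image-coords β = proj₁ (proj₂ (image-coords-InFace T {β = β} T-cube (λ _ → tt)))

  image-unit : ∀ β m → 0ℚ ≤ image β m × image β m ≤ 1ℚ
  image-unit β = proj₂ (proj₂ (image-coords-InFace T {β = β} T-cube (λ _ → tt)))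

  -- a and w t are coordinates of the images of the corners A and A + vₜ.
  a : Fin n → ℚ
  a = image (λ _ → false)

  w : Fin n → Fin n → ℚ
  w t = image ⁅ t ⁆

  act : (Fin n → ℚ) → Fin n → ℚ
  act = affine (λ t m → w t m - a m) a

  Tℚ-point : ∀ β j → Tℚ (point (bit ∘ β)) j ≡ point (image β) j
  Tℚ-point β j = begin
    Tℚ (point (bit ∘ β)) j          ≡⟨ affine-cong matrixᵀ (toQ (LatAff.b T)) (vertex-coords β) j ⟨
    Tℚ (toQ (vertex A v β)) j       ≡⟨ toQ-apply (vertex A v β) j ⟨
    toQ (apply T (vertex A v β)) j  ≡⟨ image-coords β j ⟩
    point (image β) j               ∎
    where open ≡-Reasoning

  apply-coords : ∀ {x γ} → Coords (toQ x) γ → Coords (toQ (apply T x)) (act γ)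
  apply-coords {x} {γ} x≗γ j = begin
    toQ (apply T x) j
      ≡⟨ toQ-apply x j ⟩
    Tℚ (toQ x) j
      ≡⟨ affine-cong matrixᵀ (toQ (LatAff.b T)) (λ k → trans (x≗γ k) (affine-basis edges (toQ A) γ k)) j ⟩
    Tℚ (λ k → corner k + sumℚ (λ t → γ t * (point (bit ∘ ⁅ t ⁆) k - corner k))) j
      ≡⟨ affine-combination matrixᵀ (toQ (LatAff.b T)) corner γ (λ t → point (bit ∘ ⁅ t ⁆)) j ⟩
    Tℚ corner j + sumℚ (λ t → γ t * (Tℚ (point (bit ∘ ⁅ t ⁆)) j - Tℚ corner j))
      ≡⟨ cong₂ _+_ (Tℚ-point (λ _ → false) j)
                   (Σℚ.Σ-cong (λ t → cong (γ t *_) (cong₂ _-_ (Tℚ-point ⁅ t ⁆ j) (Tℚ-point (λ _ → false) j)))) ⟩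
    point a j + sumℚ (λ t → γ t * (point (w t) j - point a j))
      ≡⟨ affine-combination edges (toQ A) a γ w j ⟨
    point (act γ) j ∎
    where
    open ≡-Reasoning
    corner : QPt n
    corner = point (λ _ → 0ℚ)

  act-coords : ∀ β → Coords (toQ (apply T (vertex A v β))) (act (bit ∘ β))
  act-coords β = apply-coords {vertex A v β} {bit ∘ β} (vertex-coords β)

  act-InFace : ∀ {f g β} → SameHull (imgFaceVerts T A v f) (faceVerts A v g) → VertexOf f β →
               InFace g (act (bit ∘ β))
  act-InFace {g = g} {β} T[f]=g vβ m = subst (InPat (g m)) γ≡act (proj₂ (proj₂ image∈g) m)
    where
    image∈g = image-coords-InFace T T[f]=g vβ
    γ≡act = coords-unique independent {γ = proj₁ image∈g} {act (bit ∘ β)} (proj₁ (proj₂ image∈g)) (act-coords β) m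

  vertex-coordinate-on-segment :
    ∀ {f g β} → SameHull (imgFaceVerts T A v f) (faceVerts A v g) → VertexOf g β → ∀ t m →
    (∀ β′ → VertexOf f β′ → act (bit ∘ β′) m ≡ a m + bit (β′ t) * (w t m - a m)) →
    ∃ λ s → (0ℚ ≤ s × s ≤ 1ℚ) × bit (β m) ≡ a m + s * (w t m - a m)
  vertex-coordinate-on-segment {f} {g} {β} (_ , g⊆T[f]) vβ t m along =
    sumℚ (λ k → c k * bit (β′ k t)) ,
    InPat-convex free c (λ k → bit (β′ k t)) c≥0 Σc≡1 (λ k → bit-unit (β′ k t)) ,
    (begin
      bit (β m)
        ≡⟨ coords-unique independent {γ = bit ∘ β} {δ} (vertex-coords β) β-coords m ⟩
      sumℚ (λ k → c k * act (bit ∘ β′ k) m)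
        ≡⟨ Σℚ.Σ-cong (λ k → cong (c k *_) (along (β′ k) (β′-vertex k))) ⟩
      sumℚ (λ k → c k * (a m + bit (β′ k t) * (w t m - a m)))
        ≡⟨ convex-line c (λ k → bit (β′ k t)) Σc≡1 (a m) (w t m - a m) ⟩
      a m + sumℚ (λ k → c k * bit (β′ k t)) * (w t m - a m) ∎)
    where
    open ≡-Reasoning
    ys = imgFaceVerts T A v f
    β∈T[f] = InHull-generator {ys = ys} g⊆T[f] (vertex-member vβ)
    c = proj₁ β∈T[f]
    c≥0 = proj₁ (proj₂ β∈T[f])
    Σc≡1 = proj₁ (proj₂ (proj₂ β∈T[f]))
    gens : All (λ y → ∃ λ β′ → VertexOf f β′ × y ≡ toQ (apply T (vertex A v β′))) ys
    gens = All.map⁺ (All.map (λ vβ′ → _ , vβ′ , refl) (faceBools-sound f))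
    β′ : Fin (length ys) → Fin n → Bool
    β′ k = proj₁ (All-lookup gens k)
    β′-vertex : ∀ k → VertexOf f (β′ k)
    β′-vertex k = proj₁ (proj₂ (All-lookup gens k))
    δ : Fin n → ℚ
    δ m = sumℚ (λ k → c k * act (bit ∘ β′ k) m)
    β-coords : Coords (toQ (vertex A v β)) δ
    β-coords = hull-coords {ys} c Σc≡1 (proj₂ (proj₂ (proj₂ β∈T[f]))) (λ k → act (bit ∘ β′ k))
                 (λ k j → trans (cong (λ y → y j) (proj₂ (proj₂ (All-lookup gens k)))) (act-coords (β′ k) j))

  act-single : ∀ {γ} t m → (∀ u → u ≢ t → γ u ≡ 0ℚ ⊎ w u m ≡ a m) → act γ m ≡ a m + γ t * (w t m - a m)
  act-single {γ} t m vanish = cong (a m +_) (Σℚ.Σ-single t (λ u u≢t → term≡0 (vanish u u≢t)))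
    where
    term≡0 : ∀ {u} → γ u ≡ 0ℚ ⊎ w u m ≡ a m → γ u * (w u m - a m) ≡ 0ℚ
    term≡0 {u} (inj₁ γu≡0) = trans (cong (_* (w u m - a m)) γu≡0) (ℚP.*-zeroˡ (w u m - a m))
    term≡0 {u} (inj₂ wum≡am) =
      trans (cong (λ x → γ u * (x - a m)) wum≡am) (trans (cong (γ u *_) (ℚP.+-inverseʳ (a m))) (ℚP.*-zeroʳ (γ u)))

  act-zero : ∀ m → act (λ _ → 0ℚ) m ≡ a m
  act-zero m = trans (cong (a m +_) (Σℚ.Σ-zeros {f = λ t → 0ℚ * (w t m - a m)} (λ t → ℚP.*-zeroˡ (w t m - a m))))
                     (ℚP.+-identityʳ (a m))

  act-unit : ∀ t m → act (bit ∘ ⁅ t ⁆) m ≡ w t m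
  act-unit t m = begin
    act (bit ∘ ⁅ t ⁆) m                  ≡⟨ act-single t m (λ u u≢t → inj₁ (cong bit (⁅⁆-other u≢t))) ⟩
    a m + bit (⁅ t ⁆ t) * (w t m - a m)  ≡⟨ cong (λ x → a m + bit x * (w t m - a m)) (⁅⁆-self t) ⟩
    a m + 1ℚ * (w t m - a m)             ≡⟨ solve 2 (λ a w → a :+ con 1ℚ :* (w :- a) := w) refl (a m) (w t m) ⟩
    w t m                                ∎
    where
    open ≡-Reasoning
    open ℚ-Solver

  act-pair : ∀ {l m} → m ≢ l → ∀ x → act (λ u → bit (⁅ m ⁆ u ∨ ⁅ l ⁆ u)) x ≡ a x + ((w m x - a x) + (w l x - a x))
  act-pair {l} {m} m≢l x = cong (a x +_) (begin
    sumℚ (λ u → bit (⁅ m ⁆ u ∨ ⁅ l ⁆ u) * d u)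
      ≡⟨ Σℚ.Σ-cong (λ u → trans (cong (_* d u) (bit-∨ u)) (ℚP.*-distribʳ-+ (d u) (bit (⁅ m ⁆ u)) (bit (⁅ l ⁆ u)))) ⟩
    sumℚ (λ u → bit (⁅ m ⁆ u) * d u + bit (⁅ l ⁆ u) * d u)
      ≡⟨ Σℚ.Σ-distrib-+ (λ u → bit (⁅ m ⁆ u) * d u) (λ u → bit (⁅ l ⁆ u) * d u) ⟩
    sumℚ (λ u → bit (⁅ m ⁆ u) * d u) + sumℚ (λ u → bit (⁅ l ⁆ u) * d u)
      ≡⟨ cong₂ _+_ (Σ-⁅⁆ m d) (Σ-⁅⁆ l d) ⟩
    d m + d l ∎)
    where
    open ≡-Reasoning
    d : Fin n → ℚ
    d u = w u x - a x
    bit-∨ : ∀ u → bit (⁅ m ⁆ u ∨ ⁅ l ⁆ u) ≡ bit (⁅ m ⁆ u) + bit (⁅ l ⁆ u)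
    bit-∨ u with u ≟ m | u ≟ l
    ... | yes refl | yes refl = ⊥-elim (m≢l refl)
    ... | yes _    | no _     = refl
    ... | no _     | yes _    = refl
    ... | no _     | no _     = refl

-- Symmetries of a lattice-regular cube

module FlagMap {n} (A : Pt n) (v : Fin n → Pt n) (independent : LinIndep v) (regular : LatticeRegular A v)
               (π π′ : Permutation′ n) (base : Fin n → Bool) where

  T : LatAff n
  T = proj₁ (regular (permFlag π (λ _ → false)) (permFlag π′ base))

  T-cube : SameHull (imgFaceVerts T A v fullFace) (faceVerts A v fullFace)
  T-cube = proj₁ (proj₂ (regular (permFlag π (λ _ → false)) (permFlag π′ base)))

  open Action A v independent T T-cube public

  level : ∀ k → SameHull (imgFaceVerts T A v (flagFace π (λ _ → false) k)) (faceVerts A v (flagFace π′ base k))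
  level = proj₂ (proj₂ (regular (permFlag π (λ _ → false)) (permFlag π′ base)))

  a≡base : ∀ m → a m ≡ bit (base m)
  a≡base m = trans (sym (act-zero m)) (InFace-flagFace⁻ π′ base corner-image ℕ.z≤n)
    where
    corner-image : InFace (flagFace π′ base zero) (act (λ _ → 0ℚ))
    corner-image = act-InFace {β = λ _ → false} (level zero) (VertexOf-flagFace π (λ _ → false) {k = zero} (λ _ _ → refl))

module Reflection {n} (A : Pt n) (v : Fin n → Pt n) (independent : LinIndep v) (regular : LatticeRegular A v)
                  (base : Fin n → Bool) where

  open FlagMap A v independent regular Perm.id Perm.id base public

  w-above : ∀ {l m} → toℕ l ℕ.< toℕ m → w l m ≡ a m
  w-above {l} {m} l<m = begin
    w l m                ≡⟨ act-unit l m ⟨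
    act (bit ∘ ⁅ l ⁆) m  ≡⟨ InFace-flagFace⁻ Perm.id base edge-image l<m ⟩
    bit (base m)         ≡⟨ a≡base m ⟨
    a m                  ∎
    where
    open ≡-Reasoning
    only-l : ∀ u → suc (toℕ l) ℕ.≤ toℕ u → ⁅ l ⁆ u ≡ false
    only-l u l<u = ⁅⁆-other (λ u≡l → ℕP.<-irrefl (cong toℕ (sym u≡l)) l<u)
    edge-image : InFace (flagFace Perm.id base (suc l)) (act (bit ∘ ⁅ l ⁆))
    edge-image = act-InFace {β = ⁅ l ⁆} (level (suc l)) (VertexOf-flagFace Perm.id _ only-l)

  w-diag : ∀ l → w l l ≡ bit (not (base l))
  w-diag l = opposite-endpoint (base l) (proj₁ (proj₂ flipped)) (image-unit ⁅ l ⁆ l) (begin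
    bit (not (base l))                         ≡⟨ cong (λ x → bit (x xor base l)) (⁅⁆-self l) ⟨
    bit (⁅ l ⁆ l xor base l)                   ≡⟨ proj₂ (proj₂ flipped) ⟩
    a l + s * (w l l - a l)                    ≡⟨ cong (λ x → x + s * (w l l - x)) (a≡base l) ⟩
    bit (base l) + s * (w l l - bit (base l))  ∎)
    where
    open ≡-Reasoning
    agree : ∀ m → suc (toℕ l) ℕ.≤ toℕ m → (⁅ l ⁆ m xor base m) ≡ base m
    agree m l<m = cong (_xor base m) (⁅⁆-other (λ m≡l → ℕP.<-irrefl (cong toℕ (sym m≡l)) l<m))
    along : ∀ β′ → VertexOf (flagFace Perm.id (λ _ → false) (suc l)) β′ →
            act (bit ∘ β′) l ≡ a l + bit (β′ l) * (w l l - a l)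
    along β′ vβ′ = act-single {bit ∘ β′} l l vanish
      where
      vanish : ∀ u → u ≢ l → bit (β′ u) ≡ 0ℚ ⊎ w u l ≡ a l
      vanish u u≢l with ℕP.<-cmp (toℕ u) (toℕ l)
      ... | tri< u<l _ _ = inj₂ (w-above u<l)
      ... | tri≈ _ u≡l _ = ⊥-elim (u≢l (toℕ-injective u≡l))
      ... | tri> _ _ l<u = inj₁ (cong bit (VertexOf-flagFace⁻ Perm.id (λ _ → false) vβ′ l<u))
    flipped = vertex-coordinate-on-segment (level (suc l)) (VertexOf-flagFace Perm.id base agree) l l along
    s = proj₁ flipped

  w-below : ∀ {l m} → toℕ m ℕ.< toℕ l → w l m ≡ a m
  w-below {l} {m} m<l =
    trans (no-second-step (base m) (w-diag m) (subst (λ x → 0ℚ ≤ x × x ≤ 1ℚ) pair-coord pair-image) (image-unit ⁅ l ⁆ m))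
          (sym (a≡base m))
    where
    m≢l : m ≢ l
    m≢l m≡l = ℕP.<-irrefl (cong toℕ m≡l) m<l
    pair-image : 0ℚ ≤ act (λ u → bit (⁅ m ⁆ u ∨ ⁅ l ⁆ u)) m × act (λ u → bit (⁅ m ⁆ u ∨ ⁅ l ⁆ u)) m ≤ 1ℚ
    pair-image = act-InFace {β = λ u → ⁅ m ⁆ u ∨ ⁅ l ⁆ u} T-cube (λ _ → tt) m
    pair-coord : act (λ u → bit (⁅ m ⁆ u ∨ ⁅ l ⁆ u)) m ≡ bit (base m) + ((w m m - bit (base m)) + (w l m - bit (base m)))
    pair-coord = trans (act-pair m≢l m) (cong (λ x → x + ((w m m - x) + (w l m - x))) (a≡base m))

  w-off : ∀ {t m} → t ≢ m → w t m ≡ a m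
  w-off {t} {m} t≢m with ℕP.<-cmp (toℕ t) (toℕ m)
  ... | tri< t<m _ _ = w-above t<m
  ... | tri≈ _ t≡m _ = ⊥-elim (t≢m (toℕ-injective t≡m))
  ... | tri> _ _ m<t = w-below m<t

  act-reflect : ∀ γ m → act γ m - γ m ≡ bit (base m) * (1ℚ - γ m - γ m)
  act-reflect γ m = begin
    act γ m - γ m
      ≡⟨ cong (_- γ m) (act-single {γ} m m (λ u u≢m → inj₂ (w-off u≢m))) ⟩
    a m + γ m * (w m m - a m) - γ m
      ≡⟨ cong₂ (λ x y → x + γ m * (y - x) - γ m) (a≡base m) (w-diag m) ⟩
    bit (base m) + γ m * (bit (not (base m)) - bit (base m)) - γ m
      ≡⟨ flip-difference (base m) (γ m) ⟩
    bit (base m) * (1ℚ - γ m - γ m) ∎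
    where
    open ≡-Reasoning
    open ℚ-Solver
    flip-difference : ∀ x g → bit x + g * (bit (not x) - bit x) - g ≡ bit x * (1ℚ - g - g)
    flip-difference false = solve 1 (λ g → con 0ℚ :+ g :* (con 1ℚ :- con 0ℚ) :- g := con 0ℚ :* (con 1ℚ :- g :- g)) refl
    flip-difference true  = solve 1 (λ g → con 1ℚ :+ g :* (con 0ℚ :- con 1ℚ) :- g := con 1ℚ :* (con 1ℚ :- g :- g)) refl

module Transposition {n} (A : Pt (suc n)) (v : Fin (suc n) → Pt (suc n)) (independent : LinIndep v)
                     (regular : LatticeRegular A v) (i j : Fin (suc n)) where

  open FlagMap A v independent regular (Perm.transpose i zero) (Perm.transpose j zero) (λ _ → false) public

  ⁅⁆-vanishes-later : ∀ (t u : Fin (suc n)) → 1 ℕ.≤ toℕ (Perm.transpose t zero ⟨$⟩ʳ u) → ⁅ t ⁆ u ≡ false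
  ⁅⁆-vanishes-later t u later =
    ⁅⁆-other {t = t} {u} (λ u≡t → 1≰0 (subst (λ x → 1 ℕ.≤ toℕ x) (rank≡0 u≡t) later))
    where
    1≰0 : ¬ 1 ℕ.≤ 0
    1≰0 ()
    rank≡0 : u ≡ t → Perm.transpose t zero ⟨$⟩ʳ u ≡ zero
    rank≡0 u≡t = trans (cong (Perm.transpose t zero ⟨$⟩ʳ_) u≡t) (transpose-first t)

  w-source-other : ∀ {m} → m ≢ j → w i m ≡ 0ℚ
  w-source-other {m} m≢j = begin
    w i m                ≡⟨ act-unit i m ⟨
    act (bit ∘ ⁅ i ⁆) m  ≡⟨ InFace-flagFace⁻ (Perm.transpose j zero) (λ _ → false) edge-image later ⟩
    0ℚ                   ∎
    where
    open ≡-Reasoning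
    edge-image : InFace (flagFace (Perm.transpose j zero) (λ _ → false) (suc zero)) (act (bit ∘ ⁅ i ⁆))
    edge-image = act-InFace {β = ⁅ i ⁆} (level (suc zero))
                   (VertexOf-flagFace (Perm.transpose i zero) (λ _ → false) {k = suc zero} (⁅⁆-vanishes-later i))
    later : 1 ℕ.≤ toℕ (Perm.transpose j zero ⟨$⟩ʳ m)
    later = rank-positive (Perm.transpose j zero) (transpose-first j) m≢j

  w-source-target : w i j ≡ 1ℚ
  w-source-target = opposite-endpoint false (proj₁ (proj₂ hit)) (image-unit ⁅ i ⁆ j) (begin
    1ℚ                       ≡⟨ cong bit (⁅⁆-self j) ⟨
    bit (⁅ j ⁆ j)            ≡⟨ proj₂ (proj₂ hit) ⟩
    a j + s * (w i j - a j)  ≡⟨ cong (λ x → x + s * (w i j - x)) (a≡base j) ⟩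
    0ℚ + s * (w i j - 0ℚ)    ∎)
    where
    open ≡-Reasoning
    along : ∀ β′ → VertexOf (flagFace (Perm.transpose i zero) (λ _ → false) (suc zero)) β′ →
            act (bit ∘ β′) j ≡ a j + bit (β′ i) * (w i j - a j)
    along β′ vβ′ = act-single {bit ∘ β′} i j (λ u u≢i → inj₁ (cong bit
      (VertexOf-flagFace⁻ (Perm.transpose i zero) (λ _ → false) vβ′ (rank-positive (Perm.transpose i zero) (transpose-first i) u≢i))))
    hit = vertex-coordinate-on-segment {β = ⁅ j ⁆} (level (suc zero))
            (VertexOf-flagFace (Perm.transpose j zero) (λ _ → false) {k = suc zero} (⁅⁆-vanishes-later j)) i j along
    s = proj₁ hit

  w-source≡target : ∀ m → w i m ≡ bit (⁅ j ⁆ m)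
  w-source≡target m = by-cases (m ≟ j)
    where
    by-cases : Dec (m ≡ j) → w i m ≡ bit (⁅ j ⁆ m)
    by-cases (yes refl) = trans w-source-target (cong bit (sym (⁅⁆-self m)))
    by-cases (no m≢j)   = trans (w-source-other m≢j) (cong bit (sym (⁅⁆-other m≢j)))

  act-edge : ∀ (c : Fin (suc n) → ℚ) m → act (λ u → bit (⁅ i ⁆ u) * c u) m ≡ bit (⁅ j ⁆ m) * c i
  act-edge c m = begin
    act (λ u → bit (⁅ i ⁆ u) * c u) m
      ≡⟨ act-single {λ u → bit (⁅ i ⁆ u) * c u} i m off-i ⟩
    a m + bit (⁅ i ⁆ i) * c i * (w i m - a m)
      ≡⟨ cong₂ (λ x y → x + bit y * c i * (w i m - x)) (a≡base m) (⁅⁆-self i) ⟩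
    0ℚ + 1ℚ * c i * (w i m - 0ℚ)
      ≡⟨ cong (λ x → 0ℚ + 1ℚ * c i * (x - 0ℚ)) (w-source≡target m) ⟩
    0ℚ + 1ℚ * c i * (bit (⁅ j ⁆ m) - 0ℚ)
      ≡⟨ solve 2 (λ c e → con 0ℚ :+ con 1ℚ :* c :* (e :- con 0ℚ) := e :* c) refl (c i) (bit (⁅ j ⁆ m)) ⟩
    bit (⁅ j ⁆ m) * c i ∎
    where
    open ≡-Reasoning
    open ℚ-Solver
    off-i : ∀ u → u ≢ i → bit (⁅ i ⁆ u) * c u ≡ 0ℚ ⊎ w u m ≡ a m
    off-i u u≢i = inj₁ (trans (cong (λ x → bit x * c u) (⁅⁆-other u≢i)) (ℚP.*-zeroˡ (c u)))

-- Denominators and elementarity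

denominator-∣ : ∀ r {x z} → r * fromℤ x ≡ fromℤ z → ℤ.+ ℚ.↧ₙ r ∣ x
denominator-∣ r@(ℚ.mkℚ p d-1 coprime) {x} {z} r*x≡z =
  ∣ᵤ⇒∣ (ℤC.coprime-divisor (ℤ.+ suc d-1) p x (ℕC.sym (ℕC.recompute coprime)) (∣⇒∣ᵤ (divides z p*x≡z*d)))
  where
  scaled : mkℚᵘ p d-1 ℚᵘ.* mkℚᵘ x 0 ℚᵘ.≃ mkℚᵘ z 0
  scaled = begin
    mkℚᵘ p d-1 ℚᵘ.* mkℚᵘ x 0        ≈⟨ ℚᵘP.*-cong (ℚᵘP.≃-refl {mkℚᵘ p d-1}) (toℚᵘ-fromℤ x) ⟨
    ℚ.toℚᵘ r ℚᵘ.* ℚ.toℚᵘ (fromℤ x)  ≈⟨ ℚP.toℚᵘ-homo-* r (fromℤ x) ⟨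
    ℚ.toℚᵘ (r * fromℤ x)            ≈⟨ ℚᵘP.≃-reflexive (cong ℚ.toℚᵘ r*x≡z) ⟩
    ℚ.toℚᵘ (fromℤ z)                ≈⟨ toℚᵘ-fromℤ z ⟩
    mkℚᵘ z 0                        ∎
    where open ℚᵘP.≃-Reasoning
  p*x≡z*d : p ℤ.* x ≡ z ℤ.* ℤ.+ suc d-1
  p*x≡z*d with scaled
  ... | *≡* eq = trans (sym (ℤP.*-identityʳ (p ℤ.* x))) (trans eq (cong (λ k → z ℤ.* ℤ.+ suc k) (ℕP.*-identityʳ d-1)))

between-±1 : ∀ {z} → ℤ.-1ℤ ℤ.< z → z ℤ.< ℤ.1ℤ → z ≡ ℤ.0ℤ
between-±1 {ℤ.+ zero}   _          _                   = refl
between-±1 {ℤ.+ suc _}  _          (ℤ.+<+ (ℕ.s≤s ()))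
between-±1 {ℤ.-[1+ _ ]} (ℤ.-<- ()) _

2≤denominator : ∀ r → r ≢ 0ℚ → - 1ℚ < r → r < 1ℚ → 2 ℕ.≤ ℚ.↧ₙ r
2≤denominator (ℚ.mkℚ _ (suc _) _) _ _ _ = ℕ.s≤s (ℕ.s≤s ℕ.z≤n)
2≤denominator r@(ℚ.mkℚ p zero _) r≢0 -1<r r<1 = ⊥-elim (r≢0 (ℚP.↥p≡0⇒p≡0 r (between-±1
  (subst (ℤ.-1ℤ ℤ.<_) (ℤP.*-identityʳ p) (ℚP.drop-*<* -1<r))
  (subst (ℤ._< ℤ.1ℤ) (ℤP.*-identityʳ p) (ℚP.drop-*<* r<1)))))

1-2α-bounds : ∀ {α} → 0ℚ < α × α < 1ℚ → - 1ℚ < 1ℚ - α - α × 1ℚ - α - α < 1ℚ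
1-2α-bounds {α} (0<α , α<1) =
  (begin-strict
    - 1ℚ              ≡⟨⟩
    1ℚ + - (1ℚ + 1ℚ)  <⟨ ℚP.+-monoʳ-< 1ℚ (ℚP.neg-antimono-< (ℚP.+-mono-< α<1 α<1)) ⟩
    1ℚ + - (α + α)    ≡⟨ regroup ⟨
    1ℚ - α - α        ∎) ,
  (begin-strict
    1ℚ - α - α        ≡⟨ regroup ⟩
    1ℚ + - (α + α)    <⟨ ℚP.+-monoʳ-< 1ℚ (ℚP.neg-antimono-< (ℚP.+-mono-< 0<α 0<α)) ⟩
    1ℚ + - (0ℚ + 0ℚ)  ≡⟨⟩
    1ℚ                ∎)
  where
  open ℚP.≤-Reasoning
  regroup : 1ℚ - α - α ≡ 1ℚ + - (α + α)
  regroup = ℚ-Solver.solve 1 (λ a → con 1ℚ :- a :- a := con 1ℚ :+ :- (a :+ a)) refl α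
    where open ℚ-Solver

idMat-apply : ∀ {n} i (x : Fin n → ℤ) → sumℤ (λ k → idMat i k ℤ.* x k) ≡ x i
idMat-apply i x = begin
  sumℤ (λ k → idMat i k ℤ.* x k)  ≡⟨ Σℤ.Σ-single i off-diagonal ⟩
  idMat i i ℤ.* x i               ≡⟨ cong (λ b → (if b then ℤ.1ℤ else ℤ.0ℤ) ℤ.* x i) (dec-true (i ≟ i) refl) ⟩
  ℤ.1ℤ ℤ.* x i                    ≡⟨ ℤP.*-identityˡ (x i) ⟩
  x i                             ∎
  where
  open ≡-Reasoning
  off-diagonal : ∀ k → k ≢ i → idMat i k ℤ.* x k ≡ ℤ.0ℤ
  off-diagonal k k≢i = cong (λ b → (if b then ℤ.1ℤ else ℤ.0ℤ) ℤ.* x k) (dec-false (i ≟ k) (k≢i ∘ sym))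

translation : ∀ {n} → Pt n → LatAff n
translation t = record
  { M = idMat ; Minv = idMat ; b = t
  ; invˡ = λ i j → idMat-apply i (λ k → idMat k j)
  ; invʳ = λ i j → idMat-apply i (λ k → idMat k j)
  }

scaled-not-elementary : ∀ {n} {A : Pt n} {v : Fin n → Pt n} {d} → 2 ℕ.≤ d → (∀ t k → ℤ.+ d ∣ v t k) →
                        ¬ Elementary A v
scaled-not-elementary {n} {A} {v} {d} 2≤d d∣v elementary =
  elementary (d , 2≤d , map (vertex origin q) corners , T ,
              subst (SameHull (imgFaceVerts T A v fullFace)) (map-∘ corners)
                    (SameHull-map corners (λ β j → cong fromℤ (shifted β j))))
  where
  T : LatAff n
  T = translation (λ j → ℤ.- A j)
  origin : Pt n
  origin _ = ℤ.0ℤ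
  corners = faceBools (fullFace {n})
  q : Fin n → Pt n
  q t k = _∣_.quotient (d∣v t k)
  shifted : ∀ β j → apply T (vertex A v β) j ≡ scale d (vertex origin q β) j
  shifted β j = begin
    sumℤ (λ k → idMat j k ℤ.* vertex A v β k) ℤ.+ ℤ.- A j
      ≡⟨ cong (ℤ._+ ℤ.- A j) (idMat-apply j (vertex A v β)) ⟩
    A j ℤ.+ sumℤ (λ i → if β i then v i j else ℤ.0ℤ) ℤ.- A j
      ≡⟨ solve 2 (λ a s → a :+ s :- a := s) refl (A j) _ ⟩
    sumℤ (λ i → if β i then v i j else ℤ.0ℤ)
      ≡⟨ Σℤ.Σ-cong (λ i → multiple (β i) i) ⟩
    sumℤ (λ i → ℤ.+ d ℤ.* (if β i then q i j else ℤ.0ℤ))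
      ≡⟨ Σℤ.*-distribˡ-Σ (ℤ.+ d) (λ i → if β i then q i j else ℤ.0ℤ) ⟨
    ℤ.+ d ℤ.* sumℤ (λ i → if β i then q i j else ℤ.0ℤ)
      ≡⟨ cong (ℤ.+ d ℤ.*_) (ℤP.+-identityˡ _) ⟨
    scale d (vertex origin q β) j ∎
    where
    open ≡-Reasoning
    open ℤ-Solver
    multiple : ∀ b i → (if b then v i j else ℤ.0ℤ) ≡ ℤ.+ d ℤ.* (if b then q i j else ℤ.0ℤ)
    multiple true  i = trans (_∣_.equality (d∣v i j)) (ℤP.*-comm (q i j) (ℤ.+ d))
    multiple false i = sym (ℤP.*-zeroʳ (ℤ.+ d))

module Centre {n} (A : Pt (suc n)) (v : Fin (suc n) → Pt (suc n)) (independent : LinIndep v)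
              (regular : LatticeRegular A v) where

  open Frame A v

  reflected-lattice-point : ∀ {p α} → Coords (toQ p) α → ∀ i →
                            ∃ λ (y : Pt (suc n)) → Coords (toQ y) (λ m → bit (⁅ i ⁆ m) * (1ℚ - α m - α m))
  reflected-lattice-point {p} {α} p≗α i =
    (λ k → apply T p k ℤ.- p k ℤ.+ A k) ,
    Coords-cong {γ = λ m → act α m - α m} (Coords-shift {apply T p} {p} {act α} {α} (apply-coords {p} {α} p≗α) p≗α)
                (act-reflect α)
    where open Reflection A v independent regular ⁅ i ⁆

  edge-multiple : ∀ {y : Pt (suc n)} {i c} → Coords (toQ y) (λ m → bit (⁅ i ⁆ m) * c m) →
                  ∀ t k → ∃ λ z → c i * fromℤ (v t k) ≡ fromℤ z
  edge-multiple {y} {i} {c} y-coords t k = apply T y k ℤ.- A k , (begin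
    c i * toQ (v t) k            ≡⟨ Coords-edge {toQ (apply T y)} {t} {c i} transported k ⟨
    toQ (apply T y) k - toQ A k  ≡⟨ fromℤ-- (apply T y k) (A k) ⟨
    fromℤ (apply T y k ℤ.- A k)  ∎)
    where
    open ≡-Reasoning
    open Transposition A v independent regular i t
    transported : Coords (toQ (apply T y)) (λ m → bit (⁅ t ⁆ m) * c i)
    transported = Coords-cong {γ = act (λ u → bit (⁅ i ⁆ u) * c u)} (apply-coords {y} {λ u → bit (⁅ i ⁆ u) * c u} y-coords)
                               (act-edge c)

  interior-coords-½ : Elementary A v → ∀ {p α} → (∀ i → 0ℚ < α i × α i < 1ℚ) → Coords (toQ p) α → ∀ i → α i ≡ ½
  interior-coords-½ elementary {p} {α} α∈ p≗α i with (1ℚ - α i - α i) ℚP.≟ 0ℚ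
  ... | yes r≡0 = begin
    α i                          ≡⟨ ℚ-Solver.solve 1 (λ a → a := con ½ :* (con 1ℚ :- (con 1ℚ :- a :- a))) refl (α i) ⟩
    ½ * (1ℚ - (1ℚ - α i - α i))  ≡⟨ cong (λ r → ½ * (1ℚ - r)) r≡0 ⟩
    ½                            ∎
    where
    open ≡-Reasoning
    open ℚ-Solver
  ... | no r≢0 = ⊥-elim (scaled-not-elementary {A = A} {v}
      (2≤denominator r r≢0 (proj₁ (1-2α-bounds (α∈ i))) (proj₂ (1-2α-bounds (α∈ i))))
      (λ t k → denominator-∣ r {v t k} {proj₁ (multiple t k)} (proj₂ (multiple t k)))
      elementary)
    where
    r : ℚ
    r = 1ℚ - α i - α i
    reflected = reflected-lattice-point {p} {α} p≗α i
    multiple : ∀ t k → ∃ λ z → r * fromℤ (v t k) ≡ fromℤ z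
    multiple = edge-multiple {proj₁ reflected} {i} {λ m → 1ℚ - α m - α m} (proj₂ reflected)

lemma1 : (n : ℕ) (A : Pt n) (v : Fin n → Pt n) →
    LinIndep v → Elementary A v → LatticeRegular A v →
    (∀ p q → InteriorPt A v p → InteriorPt A v q → ∀ j → p j ≡ q j) ×
    (∀ p → InteriorPt A v p → ∀ j → toQ p j ≡ center A v j)
lemma1 zero    A v _ _ _ = (λ _ _ _ _ ()) , (λ _ _ ())
lemma1 (suc n) A v independent elementary regular = unique , centred
  where
  open Frame A v
  open Centre A v independent regular

  centred : ∀ p → InteriorPt A v p → ∀ j → toQ p j ≡ center A v j
  centred p (α , α∈ , p≗α) j = begin
    toQ p j                                 ≡⟨ p≗α j ⟩
    point α j                               ≡⟨ affine-cong edges (toQ A) (interior-coords-½ elementary {p} {α} α∈ p≗α) j ⟩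
    toQ A j + sumℚ (λ i → ½ * toQ (v i) j)  ≡⟨ cong (toQ A j +_) (Σℚ.*-distribˡ-Σ ½ (λ i → toQ (v i) j)) ⟨
    center A v j                            ∎
    where open ≡-Reasoning

  unique : ∀ p q → InteriorPt A v p → InteriorPt A v q → ∀ j → p j ≡ q j
  unique p q p-interior q-interior j = fromℤ-injective (trans (centred p p-interior j) (sym (centred q q-interior j)))
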